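{- Suppose that every bridgeless graph $G$ admits five cycles (even subgraphs) such that every edge of $G$ belongs to exactly two of them (the $5$-Cycle Double Cover Conjecture). Then every bridgeless cubic graph $G$ satisfies $T(G)\leq \frac{2}{5}|V(G)|$.
   Context: Graphs are finite and loopless but may have parallel edges. A cubic graph is one in which every vertex has degree $3$. Here the "cycles" in a cycle double cover are edge sets of subgraphs in which every vertex has even degree (possibly empty). For a cubic graph $G$ and $U\subseteq V(G)$, $G_U$ denotes the cubic graph obtained from $G$ by expanding every vertex of $U$ into a triangle: a vertex $v$ with incident edges $e_1,e_2,e_3$ is replaced by three new mutually adjacent vertices $v_1,v_2,v_3$, with $e_i$ now incident to $v_i$ instead of $v$. For a bridgeless cubic graph $G$, $T(G)$ is the minimum size of a set $U\subseteq V(G)$ such that the edge set of $G_U$ is the union of four (not necessarily distinct) perfect matchings of $G_U$. -}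

module Defs where

open import Data.Nat using (ℕ; zero; suc; _+_; _*_; _≤_; _<_)
open import Data.Nat.DivMod using (_%_; _mod_)
open import Data.Fin using (Fin; zero; suc; toℕ; _≟_; _<?_)
open import Data.Bool using (Bool; true; false; _∧_; if_then_else_)
open import Data.Unit using (⊤; tt)
open import Data.Empty using (⊥)
open import Data.Product using (Σ; _×_; _,_; ∃)
open import Data.Sum using (_⊎_; inj₁; inj₂)
open import Relation.Nullary using (¬_)
open import Relation.Nullary.Decidable using (⌊_⌋)
open import Relation.Binary.PropositionalEquality using (_≡_; _≢_)
open import Relation.Binary.Construct.Closure.ReflexiveTransitive using (Star)

countF : ∀ {k} → (Fin k → Bool) → ℕ
countF {zero}  p = 0
countF {suc k} p = (if p zero then 1 else 0) + countF (λ i → p (suc i))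

-- Finite loopless multigraphs: vertices Fin n, edges Fin m,
-- edge e joins src e and tgt e (parallel edges allowed).

record Graph : Set where
  field
    n        : ℕ
    m        : ℕ
    src      : Fin m → Fin n
    tgt      : Fin m → Fin n
    loopless : ∀ e → src e ≢ tgt e
open Graph public

incident? : (G : Graph) → Fin (m G) → Fin (n G) → Bool
incident? G e v = ⌊ src G e ≟ v ⌋ Data.Bool.∨ ⌊ tgt G e ≟ v ⌋
  where import Data.Bool

-- degree of v in the spanning subgraph with edge set S (loopless, so
-- each incident edge contributes exactly 1)
degIn : (G : Graph) → (Fin (m G) → Bool) → Fin (n G) → ℕ
degIn G S v = countF (λ e → S e ∧ incident? G e v)

degree : (G : Graph) → Fin (n G) → ℕ
degree G v = degIn G (λ _ → true) v

Cubic : Graph → Set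
Cubic G = ∀ v → degree G v ≡ 3

EvenSubgraph : (G : Graph) → (Fin (m G) → Bool) → Set
EvenSubgraph G C = ∀ v → degIn G C v % 2 ≡ 0

AdjWithout : (G : Graph) → Fin (m G) → Fin (n G) → Fin (n G) → Set
AdjWithout G e x y = Σ (Fin (m G)) λ f → f ≢ e ×
  ((src G f ≡ x × tgt G f ≡ y) ⊎ (tgt G f ≡ x × src G f ≡ y))

IsBridge : (G : Graph) → Fin (m G) → Set
IsBridge G e = ¬ Star (AdjWithout G e) (src G e) (tgt G e)

Bridgeless : Graph → Set
Bridgeless G = ∀ e → Star (AdjWithout G e) (src G e) (tgt G e)

FiveCDC : Set
FiveCDC = (G : Graph) → Bridgeless G →
  Σ (Fin 5 → Fin (m G) → Bool) λ C →
    (∀ j → EvenSubgraph G (C j)) × (∀ e → countF (λ j → C j e) ≡ 2)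

Port : Bool → Set
Port true  = Fin 3
Port false = ⊤

Tri : Bool → Set
Tri true  = Fin 3
Tri false = ⊥

port : (b : Bool) → Fin 3 → Port b
port true  k = k
port false k = tt

next3 : Fin 3 → Fin 3
next3 zero             = suc zero
next3 (suc zero)       = suc (suc zero)
next3 (suc (suc zero)) = zero

module Expansion (G : Graph) (U : Fin (n G) → Bool) where

  -- vertices: v ∉ U stays, v ∈ U becomes v₀ v₁ v₂
  VU : Set
  VU = Σ (Fin (n G)) λ v → Port (U v)

  -- edges: the original edges, plus the three triangle edges at each v ∈ U
  EU : Set
  EU = Fin (m G) ⊎ Σ (Fin (n G)) λ v → Tri (U v)

  -- the position (0,1,2) of edge e among the edges at vertex w, in the
  -- order of edge indices (for cubic G this is a bijection between the
  -- three edges at w and Fin 3)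
  rank : Fin (m G) → Fin (n G) → Fin 3
  rank e w = countF (λ f → ⌊ f <? e ⌋ ∧ incident? G f w) mod 3

  atEnd : Fin (m G) → Fin (n G) → VU
  atEnd e w = w , port (U w) (rank e w)

  triSrc : (b : Bool) → Tri b → Port b
  triSrc true k = k
  triSrc false ()

  triTgt : (b : Bool) → Tri b → Port b
  triTgt true k = next3 k
  triTgt false ()

  srcU : EU → VU
  srcU (inj₁ e)       = atEnd e (src G e)
  srcU (inj₂ (v , k)) = v , triSrc (U v) k

  tgtU : EU → VU
  tgtU (inj₁ e)       = atEnd e (tgt G e)
  tgtU (inj₂ (v , k)) = v , triTgt (U v) k

  IncidentU : EU → VU → Set
  IncidentU f x = srcU f ≡ x ⊎ tgtU f ≡ x

  -- M is a perfect matching of G_U: every vertex lies on exactly one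
  -- edge of M (G_U is loopless, so this is degree 1 in M)
  PerfectMatchingU : (EU → Bool) → Set
  PerfectMatchingU M = ∀ x → Σ EU λ f → (M f ≡ true × IncidentU f x) ×
    (∀ f' → M f' ≡ true → IncidentU f' x → f' ≡ f)

  FourPMUnion : Set
  FourPMUnion = Σ (Fin 4 → EU → Bool) λ M →
    (∀ j → PerfectMatchingU (M j)) × (∀ f → Σ (Fin 4) λ j → M j f ≡ true)

-- T(G) ≤ k  ⇔  some U with |U| ≤ k has E(G_U) a union of four perfect
-- matchings.  We state T(G) ≤ (2/5)|V(G)| as: ∃ U, 5|U| ≤ 2|V(G)|.
TBoundTwoFifths : Graph → Set
TBoundTwoFifths G = Σ (Fin (n G) → Bool) λ U →
  5 * countF U ≤ 2 * n G × Expansion.FourPMUnion G U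

{-# OPTIONS --safe #-}
-- At a cubic vertex v an even subgraph uses none or two of the three edges.  If C₀, …, C₄
-- double cover E(G), the edges at v are used six times in all, so exactly three of the
-- cycles pass through v and two avoid it; each edge at v lies in two of the three passing
-- cycles, so these miss pairwise distinct edges.  Hence the sets Avoid i of vertices avoided
-- by Cᵢ have total size 2|V|, and some Cₛ avoids at most 2|V|/5 vertices; take U = Avoid s.
-- For each of the other four cycles Cⱼ, the edges of G lying in both or neither of Cⱼ, Cₛ,
-- together with the triangle edges of G_U joining two ports through which Cⱼ passes, form a
-- perfect matching Mⱼ of G_U: at a vertex on Cₛ, Cⱼ agrees with Cₛ on exactly one edge, and
-- at a corner of an expanded vertex exactly one of its three edges qualifies.  An edge of G
-- lies in two of the five cycles, so it agrees with Cₛ on some Cⱼ; a triangle edge is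
-- covered by the cycle through its two ports.

module Submission where

open import Defs
open import Data.Bool as Bool using (Bool; true; false; not; _∧_; _xor_; if_then_else_)
open import Data.Bool.Properties using (∧-identityʳ; ∧-zeroʳ; xor-same; xor-identityʳ; ¬-not)
open import Data.Fin using (Fin; zero; suc; toℕ; punchIn; _≟_; _<?_)
open import Data.Fin.Patterns using (0F; 1F; 2F)
open import Data.Fin.Properties using (all?; any?; toℕ-injective; toℕ-fromℕ<; toℕ<n)
open import Data.Nat as ℕ using (ℕ; zero; suc; _+_; _*_; _≤_; _%_; s<s; s<s⁻¹)
open import Data.Nat.DivMod using (_mod_; m<n⇒m%n≡m)
open import Data.Nat.Properties
  using (+-0-commutativeMonoid; ≤-refl; ≤-trans; <⇒≤; ≰⇒>; _≤?_; +-monoʳ-≤; +-mono-≤;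
         *-monoʳ-≤; *-comm; suc-injective; m+n≡0⇒m≡0; m+n≡0⇒n≡0)
open import Data.Product using (Σ; ∃; _×_; _,_; proj₁; proj₂; map₂)
import Data.Product as Product
open import Data.Sum as Sum using (_⊎_; inj₁; inj₂)
open import Data.Unit using (tt)
open import Data.Vec using (Vec; []; _∷_; lookup; tabulate)
open import Data.Vec.Properties using (lookup∘tabulate)
open import Function using (_∘_; _$_; mk⇔)
open import Relation.Binary.PropositionalEquality
open import Relation.Nullary using (yes; no; contradiction)
open import Relation.Nullary.Decidable
  using (Dec; ⌊_⌋; map′; _×-dec_; _→-dec_; True; toWitness; isYes≗does; does; does-⇔)
open import Relation.Unary using (Decidable)
open import Algebra.Properties.CommutativeMonoid.Sum +-0-commutativeMonoid
  using (sum; sum-cong-≗; ∑-comm)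
open ≡-Reasoning

ind : Bool → ℕ
ind b = if b then 1 else 0

countF-cong : ∀ {k} {p q : Fin k → Bool} → p ≗ q → countF p ≡ countF q
countF-cong {zero}  p≗q = refl
countF-cong {suc k} p≗q = cong₂ _+_ (cong ind (p≗q zero)) (countF-cong (p≗q ∘ suc))

countF≡sum : ∀ {k} (p : Fin k → Bool) → countF p ≡ sum (ind ∘ p)
countF≡sum {zero}  p = refl
countF≡sum {suc k} p = cong (ind (p zero) +_) (countF≡sum (p ∘ suc))

countF-false : ∀ k → countF {k} (λ _ → false) ≡ 0
countF-false zero    = refl
countF-false (suc k) = countF-false k

ind≡0⇒false : ∀ {b} → ind b ≡ 0 → b ≡ false
ind≡0⇒false {false} _ = refl

countF≡0⇒false : ∀ {k} (p : Fin k → Bool) → countF p ≡ 0 → ∀ i → p i ≡ false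
countF≡0⇒false p h zero    = ind≡0⇒false (m+n≡0⇒m≡0 _ h)
countF≡0⇒false p h (suc i) = countF≡0⇒false (p ∘ suc) (m+n≡0⇒n≡0 (ind (p zero)) h) i

countF≡1⇒unique : ∀ {k} (p : Fin k → Bool) → countF p ≡ 1 →
                  ∃ λ i → p i ≡ true × ∀ i′ → p i′ ≡ true → i′ ≡ i
countF≡1⇒unique {suc k} p h with p zero in p₀
... | true  = zero , p₀ , λ
  { zero    _  → refl
  ; (suc i) pᵢ →
      contradiction (trans (sym pᵢ) (countF≡0⇒false (p ∘ suc) (suc-injective h) i)) λ ()
  }
... | false =
  let i , pᵢ , unique = countF≡1⇒unique (p ∘ suc) h in
  suc i , pᵢ , λ
  { zero     p₀′ → contradiction (trans (sym p₀) p₀′) λ ()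
  ; (suc i′) pᵢ′ → cong suc (unique i′ pᵢ′)
  }

sum-const : ∀ k c → sum {k} (λ _ → c) ≡ k * c
sum-const zero    c = refl
sum-const (suc k) c = cong (c +_) (sum-const k c)

∃-below-average : ∀ {k} (a : Fin (suc k) → ℕ) → ∃ λ i → suc k * a i ≤ sum a
∃-below-average {zero}  a = zero , ≤-refl
∃-below-average {suc k} a with ∃-below-average (a ∘ suc)
... | i , below with a zero ≤? a (suc i)
...   | yes a₀≤aᵢ = zero , +-monoʳ-≤ (a zero) (≤-trans (*-monoʳ-≤ (suc k) a₀≤aᵢ) below)
...   | no  a₀≰aᵢ = suc i , +-mono-≤ (<⇒≤ (≰⇒> a₀≰aᵢ)) below

SelectsExactlyOne : ∀ {E : Set} → (E → Bool) → (E → Set) → Set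
SelectsExactlyOne {E} M I =
  Σ E λ e → (M e ≡ true × I e) × (∀ e′ → M e′ ≡ true → I e′ → e′ ≡ e)

ListsExactly : ∀ {E : Set} {d} → (E → Set) → (Fin d → E) → Set
ListsExactly I f = (∀ i → I (f i)) × (∀ e → I e → ∃ λ i → f i ≡ e)

selects-exactly-one : ∀ {E : Set} {d} {I : E → Set} {f : Fin d → E} (M : E → Bool) →
                      ListsExactly I f → countF (M ∘ f) ≡ 1 → SelectsExactlyOne M I
selects-exactly-one {f = f} M (f-I , I-f) once =
  let i , Mfᵢ , unique = countF≡1⇒unique (M ∘ f) once in
  f i , (Mfᵢ , f-I i) , λ e′ Me′ Ie′ →
    let i′ , fᵢ′≡e′ = I-f e′ Ie′ in
    trans (sym fᵢ′≡e′) (cong f (unique i′ (trans (cong M fᵢ′≡e′) Me′)))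

countBelow : ∀ {m} → (Fin m → Bool) → Fin m → ℕ
countBelow q e = countF (λ f → ⌊ f <? e ⌋ ∧ q f)

⌊suc<?suc⌋ : ∀ {m} (i j : Fin m) → ⌊ suc i <? suc j ⌋ ≡ ⌊ i <? j ⌋
⌊suc<?suc⌋ i j = begin
  ⌊ suc i <? suc j ⌋     ≡⟨ isYes≗does _ ⟩
  does (suc i <? suc j)  ≡⟨ does-⇔ (mk⇔ s<s⁻¹ s<s) (suc i <? suc j) (i <? j) ⟩
  does (i <? j)          ≡⟨ isYes≗does _ ⟨
  ⌊ i <? j ⌋             ∎

countBelow-zero : ∀ {m} (q : Fin (suc m) → Bool) → countBelow q zero ≡ 0
countBelow-zero {m} q = countF-false (suc m)

countBelow-suc : ∀ {m} (q : Fin (suc m) → Bool) e →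
                 countBelow q (suc e) ≡ ind (q zero) + countBelow (q ∘ suc) e
countBelow-suc q e =
  cong (ind (q zero) +_) (countF-cong λ f → cong (_∧ q (suc f)) (⌊suc<?suc⌋ f e))

record Enumeration {m} (q : Fin m → Bool) (k : ℕ) : Set where
  field
    elem            : Fin k → Fin m
    elem-true       : ∀ r → q (elem r) ≡ true
    countBelow-elem : ∀ r → countBelow q (elem r) ≡ toℕ r
    elem-onto       : ∀ e → q e ≡ true → ∃ λ r → elem r ≡ e
    countF-elem     : ∀ S → countF (λ e → S e ∧ q e) ≡ countF (S ∘ elem)
open Enumeration

module _ {m k} {q : Fin (suc m) → Bool} (E : Enumeration (q ∘ suc) k) where

  enumeration-skip : q zero ≡ false → Enumeration q k
  enumeration-skip q₀ .elem = suc ∘ E .elem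
  enumeration-skip q₀ .elem-true = E .elem-true
  enumeration-skip q₀ .countBelow-elem r =
    trans (countBelow-suc q (E .elem r)) (cong₂ _+_ (cong ind q₀) (E .countBelow-elem r))
  enumeration-skip q₀ .elem-onto zero    q₀′ = contradiction (trans (sym q₀) q₀′) λ ()
  enumeration-skip q₀ .elem-onto (suc e) qₑ  = map₂ (cong suc) (E .elem-onto e qₑ)
  enumeration-skip q₀ .countF-elem S =
    cong₂ _+_ (cong ind (trans (cong (S zero ∧_) q₀) (∧-zeroʳ _)))
              (E .countF-elem (S ∘ suc))

  enumeration-take : q zero ≡ true → Enumeration q (suc k)
  enumeration-take q₀ .elem zero    = zero
  enumeration-take q₀ .elem (suc r) = suc (E .elem r)
  enumeration-take q₀ .elem-true zero    = q₀
  enumeration-take q₀ .elem-true (suc r) = E .elem-true r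
  enumeration-take q₀ .countBelow-elem zero    = countBelow-zero q
  enumeration-take q₀ .countBelow-elem (suc r) =
    trans (countBelow-suc q (E .elem r)) (cong₂ _+_ (cong ind q₀) (E .countBelow-elem r))
  enumeration-take q₀ .elem-onto zero    _  = zero , refl
  enumeration-take q₀ .elem-onto (suc e) qₑ = Product.map suc (cong suc) (E .elem-onto e qₑ)
  enumeration-take q₀ .countF-elem S =
    cong₂ _+_ (cong ind (trans (cong (S zero ∧_) q₀) (∧-identityʳ _)))
              (E .countF-elem (S ∘ suc))

enumeration : ∀ {m} (q : Fin m → Bool) → Enumeration q (countF q)
enumeration {zero} q = record
  { elem = λ () ; elem-true = λ () ; countBelow-elem = λ () ; elem-onto = λ ()
  ; countF-elem = λ _ → refl }
enumeration {suc m} q = by-head (q zero) refl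
  where
  by-head : ∀ b → q zero ≡ b → Enumeration q (ind b + countF (q ∘ suc))
  by-head false q₀ = enumeration-skip (enumeration (q ∘ suc)) q₀
  by-head true  q₀ = enumeration-take (enumeration (q ∘ suc)) q₀

-- Exhaustive search over finite types

AllDec : Set → Set₁
AllDec A = ∀ {P : A → Set} → Decidable P → Dec (∀ x → P x)

by-exhaustion : ∀ {A : Set} {P : A → Set} (all-A? : AllDec A) (P? : Decidable P) →
                {True (all-A? P?)} → ∀ x → P x
by-exhaustion all-A? P? {w} = toWitness w

all-Bool? : AllDec Bool
all-Bool? P? = map′ (λ (t , f) → λ { true → t ; false → f }) (λ h → h true , h false)
                    (P? true ×-dec P? false)

all-Vec? : ∀ {A} → AllDec A → ∀ n → AllDec (Vec A n)
all-Vec? all-A? zero    P? = map′ (λ h → λ { [] → h }) (_$ []) (P? [])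
all-Vec? all-A? (suc n) P? = map′ (λ h → λ { (x ∷ xs) → h x xs }) (λ h x xs → h (x ∷ xs))
                                  (all-A? λ x → all-Vec? all-A? n (P? ∘ (x ∷_)))

-- How an even subgraph meets the three edges at a cubic vertex

data Trace : Set where
  avoids : Trace
  misses : Fin 3 → Trace

all-Trace? : AllDec Trace
all-Trace? P? = map′ (λ (a , m) → λ { avoids → a ; (misses k) → m k })
                     (λ h → h avoids , h ∘ misses)
                     (P? avoids ×-dec all? (P? ∘ misses))

_∈ₜ_ : Fin 3 → Trace → Bool
p ∈ₜ avoids   = false
p ∈ₜ misses k = not ⌊ p ≟ k ⌋

avoids? : Trace → Bool
avoids? avoids     = true
avoids? (misses _) = false

avoids⇒∉ : ∀ {T} → avoids? T ≡ true → ∀ p → p ∈ₜ T ≡ false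
avoids⇒∉ {avoids} _ p = refl

even-trace : (r : Fin 3 → Bool) → countF r % 2 ≡ 0 → Σ Trace λ T → ∀ p → r p ≡ p ∈ₜ T
even-trace r even with r 0F in r₀ | r 1F in r₁ | r 2F in r₂
... | false | false | false = avoids    , λ { 0F → r₀ ; 1F → r₁ ; 2F → r₂ }
... | false | true  | true  = misses 0F , λ { 0F → r₀ ; 1F → r₁ ; 2F → r₂ }
... | true  | false | true  = misses 1F , λ { 0F → r₀ ; 1F → r₁ ; 2F → r₂ }
... | true  | true  | false = misses 2F , λ { 0F → r₀ ; 1F → r₁ ; 2F → r₂ }
even-trace r () | true  | true  | true
even-trace r () | true  | false | false
even-trace r () | false | true  | false
even-trace r () | false | false | true

prev3 : Fin 3 → Fin 3
prev3 k = next3 (next3 k)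

next3-prev3 : ∀ k → next3 (prev3 k) ≡ k
next3-prev3 0F = refl
next3-prev3 1F = refl
next3-prev3 2F = refl

prev3-next3 : ∀ k → prev3 (next3 k) ≡ k
prev3-next3 0F = refl
prev3-next3 1F = refl
prev3-next3 2F = refl

passes : Trace → Fin 3 → Bool
passes T k = (k ∈ₜ T) ∧ (next3 k ∈ₜ T)

DoublyCovering : Vec Trace 5 → Set
DoublyCovering R = ∀ p → countF (λ i → p ∈ₜ lookup R i) ≡ 2

doublyCovering? : Decidable DoublyCovering
doublyCovering? R = all? λ p → countF (λ i → p ∈ₜ lookup R i) ℕ.≟ 2

two-avoid : ∀ R → DoublyCovering R → countF (λ i → avoids? (lookup R i)) ≡ 2
two-avoid = by-exhaustion (all-Vec? all-Trace? 5) λ R → doublyCovering? R →-dec (_ ℕ.≟ 2)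

passing-agrees-once : ∀ R → DoublyCovering R → ∀ s → avoids? (lookup R s) ≡ false → ∀ j →
  countF (λ p → not ((p ∈ₜ lookup R (punchIn s j)) xor (p ∈ₜ lookup R s))) ≡ 1
passing-agrees-once = by-exhaustion (all-Vec? all-Trace? 5) λ R → doublyCovering? R →-dec
  all? λ s → (avoids? (lookup R s) Bool.≟ false) →-dec all? λ j → _ ℕ.≟ 1

avoiding-other-passes : ∀ R → DoublyCovering R → ∀ s → avoids? (lookup R s) ≡ true → ∀ k →
  ∃ λ j → passes (lookup R (punchIn s j)) k ≡ true
avoiding-other-passes = by-exhaustion (all-Vec? all-Trace? 5) λ R → doublyCovering? R →-dec
  all? λ s → (avoids? (lookup R s) Bool.≟ true) →-dec all? λ k → any? λ j → _ Bool.≟ true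

other-agrees : ∀ (c : Vec Bool 5) → countF (lookup c) ≡ 2 → ∀ s →
  ∃ λ j → lookup c (punchIn s j) ≡ lookup c s
other-agrees = by-exhaustion (all-Vec? all-Bool? 5) λ c → (_ ℕ.≟ 2) →-dec
  all? λ s → any? λ j → lookup c (punchIn s j) Bool.≟ lookup c s

-- The membership in Mⱼ of the edges cornerEdge v u k, when Cⱼ has trace T at v.
atCorner : Trace → Fin 3 → Fin 3 → Bool
atCorner T k 0F = not (k ∈ₜ T)
atCorner T k 1F = passes T k
atCorner T k 2F = passes T (prev3 k)

atCorner-once : ∀ T k → countF (atCorner T k) ≡ 1
atCorner-once = by-exhaustion all-Trace? λ T → all? λ k → _ ℕ.≟ 1

module _ (G : Graph) where

  incident-src : ∀ e → incident? G e (src G e) ≡ true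
  incident-src e with src G e ≟ src G e
  ... | yes _ = refl
  ... | no ¬p = contradiction refl ¬p

  incident-tgt : ∀ e → incident? G e (tgt G e) ≡ true
  incident-tgt e with src G e ≟ tgt G e | tgt G e ≟ tgt G e
  ... | yes _ | _     = refl
  ... | no _  | yes _ = refl
  ... | no _  | no ¬p = contradiction refl ¬p

  incident⇒end : ∀ {e v} → incident? G e v ≡ true → src G e ≡ v ⊎ tgt G e ≡ v
  incident⇒end {e} {v} h with src G e ≟ v | tgt G e ≟ v
  ... | yes p | _     = inj₁ p
  ... | no _  | yes q = inj₂ q

toℕ-mod : ∀ {n} (k : Fin (suc n)) → toℕ k mod suc n ≡ k
toℕ-mod k = toℕ-injective (trans (toℕ-fromℕ< _) (m<n⇒m%n≡m (toℕ<n k)))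

-- ports v lists the edges at v in increasing order, the order that Expansion.rank counts in.
module Ports (G : Graph) (cubic : Cubic G) where

  at : Fin (n G) → Fin (m G) → Bool
  at v e = incident? G e v

  ports : ∀ v → Enumeration (at v) 3
  ports v = subst (Enumeration (at v)) (cubic v) (enumeration (at v))

  edgeAt : Fin (n G) → Fin 3 → Fin (m G)
  edgeAt v = ports v .elem

  rankAt : Fin (m G) → Fin (n G) → Fin 3
  rankAt e v = countBelow (at v) e mod 3

  edgeAt-at : ∀ v k → at v (edgeAt v k) ≡ true
  edgeAt-at v = ports v .elem-true

  rankAt-edgeAt : ∀ v k → rankAt (edgeAt v k) v ≡ k
  rankAt-edgeAt v k = trans (cong (_mod 3) (ports v .countBelow-elem k)) (toℕ-mod k)

  edgeAt-rankAt : ∀ {e v} → at v e ≡ true → edgeAt v (rankAt e v) ≡ e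
  edgeAt-rankAt {e} {v} atᵥ =
    let k , eₖ≡e = ports v .elem-onto e atᵥ in
    begin
      edgeAt v (rankAt e v)               ≡⟨ cong (λ f → edgeAt v (rankAt f v)) eₖ≡e ⟨
      edgeAt v (rankAt (edgeAt v k) v)    ≡⟨ cong (edgeAt v) (rankAt-edgeAt v k) ⟩
      edgeAt v k                          ≡⟨ eₖ≡e ⟩
      e                                   ∎

  degIn-edgeAt : ∀ S v → degIn G S v ≡ countF (S ∘ edgeAt v)
  degIn-edgeAt S v = ports v .countF-elem S

module Corners (G : Graph) (cubic : Cubic G) (U : Fin (n G) → Bool) where
  open Ports G cubic
  open Expansion G U

  -- The index of a vertex not in U is junk: it has a single port.
  index : ∀ {b} → Port b → Fin 3
  index {true}  k  = k
  index {false} tt = 0F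

  port-index : ∀ b (t : Port b) → port b (index t) ≡ t
  port-index true  t  = refl
  port-index false tt = refl

  index-port : ∀ {b} → b ≡ true → ∀ k → index (port b k) ≡ k
  index-port refl k = refl

  Port-false : ∀ {b} → b ≡ false → (t t′ : Port b) → t ≡ t′
  Port-false refl tt tt = refl

  triIndex : ∀ {b} → Tri b → Fin 3
  triIndex {true} k = k

  Tri⇒true : ∀ {b} → Tri b → b ≡ true
  Tri⇒true {true} _ = refl

  toTri : ∀ {b} → b ≡ true → Fin 3 → Tri b
  toTri refl k = k

  triIndex-toTri : ∀ {b} (u : b ≡ true) k → triIndex (toTri u k) ≡ k
  triIndex-toTri refl k = refl

  toTri-triIndex : ∀ {b} (u : b ≡ true) k′ → toTri u (triIndex k′) ≡ k′
  toTri-triIndex refl k′ = refl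

  triSrc-port : ∀ b (k′ : Tri b) → triSrc b k′ ≡ port b (triIndex k′)
  triSrc-port true k′ = refl

  triTgt-port : ∀ b (k′ : Tri b) → triTgt b k′ ≡ port b (next3 (triIndex k′))
  triTgt-port true k′ = refl

  corner : Fin (n G) → Fin 3 → VU
  corner v k = v , port (U v) k

  corner-index : ∀ x → corner (proj₁ x) (index (proj₂ x)) ≡ x
  corner-index (v , t) = cong (v ,_) (port-index (U v) t)

  corner-injective : ∀ {v r k} → U v ≡ true → corner v r ≡ corner v k → r ≡ k
  corner-injective {v} {r} {k} u eq = begin
    r                     ≡⟨ index-port u r ⟨
    index (port (U v) r)  ≡⟨ cong (λ x → index (proj₂ x)) eq ⟩
    index (port (U v) k)  ≡⟨ index-port u k ⟩
    k                     ∎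

  corners-outside : ∀ {v} → U v ≡ false → ∀ r k → corner v r ≡ corner v k
  corners-outside {v} u r k = cong (v ,_) (Port-false u _ _)

  incident-original : ∀ {e x} → IncidentU (inj₁ e) x →
                      at (proj₁ x) e ≡ true × corner (proj₁ x) (rankAt e (proj₁ x)) ≡ x
  incident-original (inj₁ refl) = incident-src G _ , refl
  incident-original (inj₂ refl) = incident-tgt G _ , refl

  original-incident : ∀ v k → IncidentU (inj₁ (edgeAt v k)) (corner v k)
  original-incident v k = Sum.map end-at end-at (incident⇒end G (edgeAt-at v k))
    where
    end-at : ∀ {w} → w ≡ v → corner w (rankAt (edgeAt v k) w) ≡ corner v k
    end-at refl = cong (corner v) (rankAt-edgeAt v k)

  incident-triangle : ∀ {w k′ x} → IncidentU (inj₂ (w , k′)) x →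
    proj₁ x ≡ w × (corner w (triIndex k′) ≡ x ⊎ corner w (next3 (triIndex k′)) ≡ x)
  incident-triangle {w} {k′} (inj₁ refl) = refl , inj₁ (cong (w ,_) (sym (triSrc-port _ k′)))
  incident-triangle {w} {k′} (inj₂ refl) = refl , inj₂ (cong (w ,_) (sym (triTgt-port _ k′)))

  edges-outside : ∀ {v} → U v ≡ false → ∀ k →
                  ListsExactly (λ f → IncidentU f (corner v k)) (inj₁ ∘ edgeAt v)
  edges-outside {v} u k = incident , classify
    where
    incident : ∀ p → IncidentU (inj₁ (edgeAt v p)) (corner v k)
    incident p =
      subst (IncidentU (inj₁ (edgeAt v p))) (corners-outside u p k) (original-incident v p)
    classify : ∀ f → IncidentU f (corner v k) → ∃ λ p → inj₁ (edgeAt v p) ≡ f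
    classify (inj₁ e) inc =
      rankAt e v , cong inj₁ (edgeAt-rankAt (proj₁ (incident-original inc)))
    classify (inj₂ (w , k′)) inc =
      let v≡w = proj₁ (incident-triangle inc) in
      contradiction (trans (sym u) (trans (cong U v≡w) (Tri⇒true k′))) λ ()

  cornerEdge : ∀ v → U v ≡ true → Fin 3 → Fin 3 → EU
  cornerEdge v u k 0F = inj₁ (edgeAt v k)
  cornerEdge v u k 1F = inj₂ (v , toTri u k)
  cornerEdge v u k 2F = inj₂ (v , toTri u (prev3 k))

  edges-inside : ∀ {v} (u : U v ≡ true) k →
                 ListsExactly (λ f → IncidentU f (corner v k)) (cornerEdge v u k)
  edges-inside {v} u k = incident , classify
    where
    incident : ∀ i → IncidentU (cornerEdge v u k i) (corner v k)
    incident 0F = original-incident v k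
    incident 1F = inj₁ (cong (v ,_) (begin
      triSrc (U v) (toTri u k)           ≡⟨ triSrc-port (U v) _ ⟩
      port (U v) (triIndex (toTri u k))  ≡⟨ cong (port (U v)) (triIndex-toTri u k) ⟩
      port (U v) k                       ∎))
    incident 2F = inj₂ (cong (v ,_) (begin
      triTgt (U v) (toTri u (prev3 k))
        ≡⟨ triTgt-port (U v) _ ⟩
      port (U v) (next3 (triIndex (toTri u (prev3 k))))
        ≡⟨ cong (port (U v) ∘ next3) (triIndex-toTri u (prev3 k)) ⟩
      port (U v) (next3 (prev3 k))
        ≡⟨ cong (port (U v)) (next3-prev3 k) ⟩
      port (U v) k
        ∎))
    classify : ∀ f → IncidentU f (corner v k) → ∃ λ i → cornerEdge v u k i ≡ f
    classify (inj₁ e) inc =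
      let atᵥ , eq = incident-original inc in
      0F , cong inj₁ (begin
        edgeAt v k            ≡⟨ cong (edgeAt v) (corner-injective u eq) ⟨
        edgeAt v (rankAt e v) ≡⟨ edgeAt-rankAt atᵥ ⟩
        e                     ∎)
    classify (inj₂ (w , k′)) inc with incident-triangle inc
    ... | refl , inj₁ eq = 1F , cong (λ k″ → inj₂ (v , k″)) (begin
      toTri u k               ≡⟨ cong (toTri u) (corner-injective u eq) ⟨
      toTri u (triIndex k′)   ≡⟨ toTri-triIndex u k′ ⟩
      k′                      ∎)
    ... | refl , inj₂ eq = 2F , cong (λ k″ → inj₂ (v , k″)) (begin
      toTri u (prev3 k)                       ≡⟨ cong (toTri u ∘ prev3) (corner-injective u eq) ⟨
      toTri u (prev3 (next3 (triIndex k′)))   ≡⟨ cong (toTri u) (prev3-next3 _) ⟩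
      toTri u (triIndex k′)                   ≡⟨ toTri-triIndex u k′ ⟩
      k′                                      ∎)

-- The four perfect matchings

module Construction (G : Graph) (cubic : Cubic G) (C : Fin 5 → Fin (m G) → Bool)
                    (C-even : ∀ i → EvenSubgraph G (C i))
                    (C-double : ∀ e → countF (λ i → C i e) ≡ 2) where
  open Ports G cubic

  traceAt : ∀ v i → Σ Trace λ T → ∀ p → C i (edgeAt v p) ≡ p ∈ₜ T
  traceAt v i =
    even-trace (C i ∘ edgeAt v) (subst (λ d → d % 2 ≡ 0) (degIn-edgeAt (C i) v) (C-even i v))

  traces : Fin (n G) → Vec Trace 5
  traces v = tabulate (proj₁ ∘ traceAt v)

  trace : Fin 5 → Fin (n G) → Trace
  trace i v = lookup (traces v) i

  C-trace : ∀ i v p → C i (edgeAt v p) ≡ p ∈ₜ trace i v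
  C-trace i v p =
    trans (proj₂ (traceAt v i) p) (cong (p ∈ₜ_) (sym (lookup∘tabulate (proj₁ ∘ traceAt v) i)))

  traces-double : ∀ v → DoublyCovering (traces v)
  traces-double v p = trans (countF-cong λ i → sym (C-trace i v p)) (C-double (edgeAt v p))

  other-agrees-on : ∀ e s → ∃ λ j → C (punchIn s j) e ≡ C s e
  other-agrees-on e s =
    let j , agree = other-agrees column (trans (countF-cong (lookup∘tabulate Cₑ)) (C-double e)) s
    in j , (begin
      C (punchIn s j) e              ≡⟨ lookup∘tabulate Cₑ (punchIn s j) ⟨
      lookup column (punchIn s j)    ≡⟨ agree ⟩
      lookup column s                ≡⟨ lookup∘tabulate Cₑ s ⟩
      C s e                          ∎)
    where
    Cₑ : Fin 5 → Bool
    Cₑ i = C i e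
    column : Vec Bool 5
    column = tabulate Cₑ

  Avoid : Fin 5 → Fin (n G) → Bool
  Avoid i v = avoids? (trace i v)

  total-avoidances : sum (λ i → countF (Avoid i)) ≡ 2 * n G
  total-avoidances = begin
    sum (λ i → countF (Avoid i))                ≡⟨ sum-cong-≗ (countF≡sum ∘ Avoid) ⟩
    sum (λ i → sum (λ v → ind (Avoid i v)))     ≡⟨ ∑-comm (λ i v → ind (Avoid i v)) ⟩
    sum (λ v → sum (λ i → ind (Avoid i v)))     ≡⟨ sum-cong-≗ two-avoid-at ⟩
    sum {n G} (λ _ → 2)                         ≡⟨ sum-const (n G) 2 ⟩
    n G * 2                                     ≡⟨ *-comm (n G) 2 ⟩
    2 * n G                                     ∎
    where
    two-avoid-at : ∀ v → sum (λ i → ind (Avoid i v)) ≡ 2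
    two-avoid-at v =
      trans (sym (countF≡sum (λ i → Avoid i v))) (two-avoid (traces v) (traces-double v))

  rarely-avoiding : ∃ λ s → 5 * countF (Avoid s) ≤ 2 * n G
  rarely-avoiding =
    let s , below = ∃-below-average (λ i → countF (Avoid i)) in
    s , subst (5 * countF (Avoid s) ≤_) total-avoidances below

  module Matchings (s : Fin 5) where
    open Expansion G (Avoid s)
    open Corners G cubic (Avoid s)

    other : Fin 4 → Fin 5
    other = punchIn s

    uses : (Fin (m G) → Bool) → Fin (n G) → Fin 3 → Bool
    uses D v k = D (edgeAt v k) ∧ D (edgeAt v (next3 k))

    uses-trace : ∀ i v k → uses (C i) v k ≡ passes (trace i v) k
    uses-trace i v k = cong₂ _∧_ (C-trace i v k) (C-trace i v (next3 k))

    M : Fin 4 → EU → Bool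
    M j (inj₁ e)        = not (C (other j) e xor C s e)
    M j (inj₂ (v , k′)) = uses (C (other j)) v (triIndex k′)

    matched-outside : ∀ {v} → Avoid s v ≡ false → ∀ j k →
                      SelectsExactlyOne (M j) (λ f → IncidentU f (corner v k))
    matched-outside {v} u j k = selects-exactly-one (M j) (edges-outside u k) (begin
      countF (λ p → not (C (other j) (edgeAt v p) xor C s (edgeAt v p)))
        ≡⟨ countF-cong (λ p → cong₂ (λ a b → not (a xor b))
                                    (C-trace (other j) v p) (C-trace s v p)) ⟩
      countF (λ p → not ((p ∈ₜ trace (other j) v) xor (p ∈ₜ trace s v)))
        ≡⟨ passing-agrees-once (traces v) (traces-double v) s u j ⟩
      1 ∎)

    matched-inside : ∀ {v} (u : Avoid s v ≡ true) j k →
                     SelectsExactlyOne (M j) (λ f → IncidentU f (corner v k))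
    matched-inside {v} u j k = selects-exactly-one (M j) (edges-inside u k)
      (trans (countF-cong values) (atCorner-once (trace (other j) v) k))
      where
      Cⱼ : Fin (m G) → Bool
      Cⱼ = C (other j)
      values : ∀ i → M j (cornerEdge v u k i) ≡ atCorner (trace (other j) v) k i
      values 0F = begin
        not (C (other j) (edgeAt v k) xor C s (edgeAt v k))
          ≡⟨ cong₂ (λ a b → not (a xor b))
                   (C-trace (other j) v k) (trans (C-trace s v k) (avoids⇒∉ u k)) ⟩
        not ((k ∈ₜ trace (other j) v) xor false)
          ≡⟨ cong not (xor-identityʳ _) ⟩
        not (k ∈ₜ trace (other j) v)
          ∎
      values 1F = trans (cong (uses Cⱼ v) (triIndex-toTri u k)) (uses-trace (other j) v k)
      values 2F =
        trans (cong (uses Cⱼ v) (triIndex-toTri u (prev3 k))) (uses-trace (other j) v (prev3 k))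

    perfect : ∀ j → PerfectMatchingU (M j)
    perfect j x = subst (λ x → SelectsExactlyOne (M j) (λ f → IncidentU f x)) (corner-index x)
                        (matched-at (proj₁ x) (index (proj₂ x)))
      where
      matched-at : ∀ v k → SelectsExactlyOne (M j) (λ f → IncidentU f (corner v k))
      matched-at v k with Avoid s v Bool.≟ true
      ... | yes u = matched-inside u j k
      ... | no ¬u = matched-outside (¬-not ¬u) j k

    covers : ∀ f → ∃ λ j → M j f ≡ true
    covers (inj₁ e) =
      let j , Cⱼ≡Cₛ = other-agrees-on e s in
      j , (begin
        not (C (other j) e xor C s e)  ≡⟨ cong (λ a → not (a xor C s e)) Cⱼ≡Cₛ ⟩
        not (C s e xor C s e)          ≡⟨ cong not (xor-same (C s e)) ⟩
        true                           ∎)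
    covers (inj₂ (v , k′)) =
      let j , passes-k′ =
            avoiding-other-passes (traces v) (traces-double v) s (Tri⇒true k′) (triIndex k′)
      in j , trans (uses-trace (other j) v (triIndex k′)) passes-k′

    four-matchings : FourPMUnion
    four-matchings = M , perfect , covers

theorem3p3 : FiveCDC → (G : Graph) → Bridgeless G → Cubic G → TBoundTwoFifths G
theorem3p3 five-cdc G bridgeless cubic =
  let C , C-even , C-double = five-cdc G bridgeless
      open Construction G cubic C C-even C-double
      s , few-avoided = rarely-avoiding
  in Avoid s , few-avoided , Matchings.four-matchings s
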